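{- Let $G$ be a 3-uniform hypergraph with vertex set $V$, and let $V=A\cup B\cup C$ be a semi-optimal partition. Then $$3e(A,A,A)+2e(A,A,B)\le e(A,B,C)+e(A,C,C),$$ and $$3e(B,B,B)+2e(A,B,B)\le e(A,B,C)+e(B,C,C).$$
   Context: A 3-uniform hypergraph has a finite vertex set $V$ and edges that are distinct 3-element subsets of $V$. For $X\subseteq V$, $d(X)$ is the number of edges meeting $X$. For a partition $(A,B,C)$ of $V$ (an ordered triple of pairwise disjoint sets with union $V$), its degree is $d(A,B,C)=d(A)+d(B)+d(C)$. For subsets $X,Y,Z$ of $V$, $e(X,Y,Z)$ is the number of distinct edges of the form $\{x,y,z\}$ with $x\in X$, $y\in Y$, $z\in Z$ (so e.g. $e(A,A,B)$ is the number of edges with two vertices in $A$ and one in $B$). The partition $(A,B,C)$ is semi-optimal if its degree cannot be increased by moving a single vertex into $C$, i.e. $d(A,B,C)\ge d(A\setminus\{v\},B,C\cup\{v\})$ for every $v\in A$ and $d(A,B,C)\ge d(A,B\setminus\{v\},C\cup\{v\})$ for every $v\in B$. -}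

module Defs where

open import Data.Nat using (ℕ; zero; suc; _+_; _*_; _≤_)
open import Data.Fin using (Fin; _<_; _≟_)
open import Data.Bool using (Bool; true; false; _∨_; _∧_; if_then_else_)
open import Data.Product using (_×_; _,_)
open import Data.List using (List; []; _∷_)
open import Data.List.Relation.Unary.All using (All)
open import Data.List.Relation.Unary.Unique.Propositional using (Unique)
open import Relation.Nullary.Decidable using (does)

-- A 3-element subset {a,b,c} of Fin n is represented by the sorted triple (a,b,c), a < b < c.
Triple : ℕ → Set
Triple n = Fin n × Fin n × Fin n

Sorted : ∀ {n} → Triple n → Set
Sorted (a , b , c) = (a < b) × (b < c)

record Hypergraph3 (n : ℕ) : Set where
  field
    edges  : List (Triple n)
    sorted : All Sorted edges
    unique : Unique edges
open Hypergraph3 public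

-- The three parts of a partition (A,B,C); a partition of V is a map V → Part
-- (A = vertices labelled pA, etc.); this is exactly an ordered triple of disjoint sets covering V.
data Part : Set where
  pA pB pC : Part

_==_ : Part → Part → Bool
pA == pA = true
pB == pB = true
pC == pC = true
_  == _  = false

Partition : ℕ → Set
Partition n = Fin n → Part

count : ∀ {X : Set} → (X → Bool) → List X → ℕ
count f [] = zero
count f (x ∷ xs) = if f x then suc (count f xs) else count f xs

d : ∀ {n} → Hypergraph3 n → Partition n → Part → ℕ
d G p X = count (λ { (a , b , c) → (p a == X) ∨ (p b == X) ∨ (p c == X) }) (edges G)

deg : ∀ {n} → Hypergraph3 n → Partition n → ℕ
deg G p = d G p pA + d G p pB + d G p pC

fits : ∀ {n} → Partition n → Part → Part → Part → Fin n → Fin n → Fin n → Bool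
fits p X Y Z x y z = (p x == X) ∧ (p y == Y) ∧ (p z == Z)

e : ∀ {n} → Hypergraph3 n → Partition n → Part → Part → Part → ℕ
e G p X Y Z = count (λ { (a , b , c) →
     fits p X Y Z a b c ∨ fits p X Y Z a c b ∨ fits p X Y Z b a c ∨
     fits p X Y Z b c a ∨ fits p X Y Z c a b ∨ fits p X Y Z c b a }) (edges G)

moveToC : ∀ {n} → Partition n → Fin n → Partition n
moveToC p v w = if does (w ≟ v) then pC else p w

SemiOptimal : ∀ {n} → Hypergraph3 n → Partition n → Set
SemiOptimal G p =
  (∀ v → p v ≡ pA → deg G (moveToC p v) ≤ deg G p) ×
  (∀ v → p v ≡ pB → deg G (moveToC p v) ≤ deg G p)
  where open import Relation.Binary.PropositionalEquality using (_≡_)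

-- Moving a vertex v of A into C changes, edge by edge, the number of parts an edge meets, and
-- semi-optimality says the total change over the edges at v is not positive. Summing over all
-- v ∈ A counts every edge once per vertex it has in A: an AAA edge gains a part from each of
-- its three A-vertices, an AAB edge from each of its two, an ABC or ACC edge loses one, and no
-- other edge changes.
module Submission where

open import Defs
open import Data.Nat using (ℕ; zero; suc; _+_; _*_; _∸_; _≤_; _≡ᵇ_; z≤n)
open import Data.Nat.Properties
  using (+-0-commutativeMonoid; +-*-semiring; +-identityʳ; *-zeroʳ; *-monoʳ-≤; +-mono-≤; +-monoˡ-≤;
         +-cancelˡ-≤; n∸n≡0; ≡ᵇ⇒≡; module ≤-Reasoning)
open import Data.Bool using (Bool; true; false; T; _∧_; _∨_; if_then_else_)
open import Data.Bool.Properties using (T-∧)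
open import Data.Fin as Fin using (Fin; _≟_)
open import Data.Fin.Properties using (<⇒≢; <-trans)
open import Data.List using (List; []; _∷_; length; lookup)
open import Data.List.Membership.Propositional.Properties using (∈-lookup)
import Data.List.Relation.Unary.All as All
open import Data.Product using (_×_; _,_; proj₁; proj₂)
open import Function using (_∘_; Equivalence)
open import Relation.Nullary.Decidable using (yes; no; does; dec-true; dec-false)
open import Data.Empty using (⊥-elim)
open import Relation.Binary.PropositionalEquality
  using (_≡_; _≢_; refl; sym; trans; cong; cong₂; subst₂; module ≡-Reasoning)
open import Algebra.Properties.CommutativeMonoid.Sum +-0-commutativeMonoid
  using (sum-syntax; ∑-distrib-+; ∑-comm; sum-cong-≗; sum-replicate-zero)
open import Algebra.Properties.Semiring.Sum +-*-semiring using (*-distribˡ-sum)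

𝟙 : Bool → ℕ
𝟙 b = if b then 1 else 0

==⇒≡ : ∀ x y → x == y ≡ true → x ≡ y
==⇒≡ pA pA _ = refl
==⇒≡ pB pB _ = refl
==⇒≡ pC pC _ = refl
==⇒≡ pA pB ()
==⇒≡ pA pC ()
==⇒≡ pB pA ()
==⇒≡ pB pC ()
==⇒≡ pC pA ()
==⇒≡ pC pB ()

every : (Part → Bool) → Bool
every P = P pA ∧ P pB ∧ P pC

every-sound : ∀ P → T (every P) → ∀ x → T (P x)
every-sound P t pA = proj₁ (Equivalence.to (T-∧ {P pA}) t)
every-sound P t pB = proj₁ (Equivalence.to (T-∧ {P pB}) (proj₂ (Equivalence.to (T-∧ {P pA}) t)))
every-sound P t pC = proj₂ (Equivalence.to (T-∧ {P pB}) (proj₂ (Equivalence.to (T-∧ {P pA}) t)))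

-- Identities between functions of three part labels, checked on all 27 labellings.
Part³-≡ : (f g : Part → Part → Part → ℕ) →
  T (every λ x → every λ y → every λ z → f x y z ≡ᵇ g x y z) → ∀ x y z → f x y z ≡ g x y z
Part³-≡ f g t x y z = ≡ᵇ⇒≡ _ _
  (every-sound (λ z → f x y z ≡ᵇ g x y z) (every-sound (λ y → every λ z → f x y z ≡ᵇ g x y z)
    (every-sound (λ x → every λ y → every λ z → f x y z ≡ᵇ g x y z) t x) y) z)

m+[n∸m]≡n+[m∸n] : ∀ m n → m + (n ∸ m) ≡ n + (m ∸ n)
m+[n∸m]≡n+[m∸n] zero    zero    = refl
m+[n∸m]≡n+[m∸n] zero    (suc n) = sym (+-identityʳ (suc n))
m+[n∸m]≡n+[m∸n] (suc m) zero    = +-identityʳ (suc m)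
m+[n∸m]≡n+[m∸n] (suc m) (suc n) = cong suc (m+[n∸m]≡n+[m∸n] m n)

∑-mono-≤ : ∀ {n} {f g : Fin n → ℕ} → (∀ i → f i ≤ g i) → ∑[ i < n ] f i ≤ ∑[ i < n ] g i
∑-mono-≤ {zero}  f≤g = z≤n
∑-mono-≤ {suc n} f≤g = +-mono-≤ (f≤g Fin.zero) (∑-mono-≤ (f≤g ∘ Fin.suc))

pointMass : ∀ {n} → Fin n → ℕ → Fin n → ℕ
pointMass a t v = if does (v ≟ a) then t else 0

∑-pointMass : ∀ {n} (a : Fin n) t → ∑[ v < n ] pointMass a t v ≡ t
∑-pointMass {suc n} Fin.zero    t = trans (cong (t +_) (sum-replicate-zero n)) (+-identityʳ t)
∑-pointMass {suc n} (Fin.suc a) t = ∑-pointMass a t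

∑-supportedOn₃ : ∀ {n} (f : Fin n → ℕ) {a b c} → a ≢ b → a ≢ c → b ≢ c →
  (∀ v → v ≢ a → v ≢ b → v ≢ c → f v ≡ 0) → ∑[ v < n ] f v ≡ f a + f b + f c
∑-supportedOn₃ {n} f {a} {b} {c} a≢b a≢c b≢c outside = begin
  ∑[ v < n ] f v                                      ≡⟨ sum-cong-≗ decompose ⟩
  ∑[ v < n ] (δa v + δb v + δc v)                     ≡⟨ ∑-distrib-+ (λ v → δa v + δb v) δc ⟩
  ∑[ v < n ] (δa v + δb v) + ∑[ v < n ] δc v          ≡⟨ cong (_+ ∑[ v < n ] δc v) (∑-distrib-+ δa δb) ⟩
  ∑[ v < n ] δa v + ∑[ v < n ] δb v + ∑[ v < n ] δc v
    ≡⟨ cong₂ _+_ (cong₂ _+_ (∑-pointMass a (f a)) (∑-pointMass b (f b))) (∑-pointMass c (f c)) ⟩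
  f a + f b + f c                                     ∎
  where
  open ≡-Reasoning
  δa δb δc : Fin n → ℕ
  δa = pointMass a (f a)
  δb = pointMass b (f b)
  δc = pointMass c (f c)
  decompose : ∀ v → f v ≡ δa v + δb v + δc v
  decompose v with v ≟ a | v ≟ b | v ≟ c
  ... | yes refl | yes refl | _        = ⊥-elim (a≢b refl)
  ... | yes refl | no _     | yes refl = ⊥-elim (a≢c refl)
  ... | yes refl | no _     | no _     = sym (trans (+-identityʳ _) (+-identityʳ _))
  ... | no _     | yes refl | yes refl = ⊥-elim (b≢c refl)
  ... | no _     | yes refl | no _     = sym (+-identityʳ _)
  ... | no _     | no _     | yes refl = refl
  ... | no v≢a   | no v≢b   | no v≢c   = outside v v≢a v≢b v≢c

partsMet : Part → Part → Part → ℕ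
partsMet x y z = 𝟙 (x == pA ∨ y == pA ∨ z == pA) + 𝟙 (x == pB ∨ y == pB ∨ z == pB)
               + 𝟙 (x == pC ∨ y == pC ∨ z == pC)

increase decrease : ℕ → ℕ → ℕ
increase old new = new ∸ old
decrease old new = old ∸ new

-- Summed over the positions labelled X: the change of partsMet, measured by φ old new, when the
-- label at that position becomes pC.
localChange : (ℕ → ℕ → ℕ) → Part → Part → Part → Part → ℕ
localChange φ X x y z =
    𝟙 (x == X) * φ (partsMet x y z) (partsMet pC y z)
  + 𝟙 (y == X) * φ (partsMet x y z) (partsMet x pC z)
  + 𝟙 (z == X) * φ (partsMet x y z) (partsMet x y pC)

EdgeType : Set
EdgeType = Part × Part × Part

labelsFit : Part → Part → Part → Part → Part → Part → Bool
labelsFit X Y Z x y z = (x == X) ∧ (y == Y) ∧ (z == Z)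

ofType : EdgeType → Part → Part → Part → Bool
ofType (X , Y , Z) x y z =
  labelsFit X Y Z x y z ∨ labelsFit X Y Z x z y ∨ labelsFit X Y Z y x z ∨
  labelsFit X Y Z y z x ∨ labelsFit X Y Z z x y ∨ labelsFit X Y Z z y x

count≡∑ : ∀ {X : Set} (f : X → Bool) (xs : List X) →
  count f xs ≡ ∑[ i < length xs ] 𝟙 (f (lookup xs i))
count≡∑ f []       = refl
count≡∑ f (x ∷ xs) with f x
... | true  = cong suc (count≡∑ f xs)
... | false = count≡∑ f xs

module _ {n : ℕ} where

  ∑ₑ : Hypergraph3 n → (Triple n → ℕ) → ℕ
  ∑ₑ G f = ∑[ i < length (edges G) ] f (lookup (edges G) i)

  atLabels : Partition n → (Part → Part → Part → ℕ) → Triple n → ℕ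
  atLabels q F (a , b , c) = F (q a) (q b) (q c)

  moveToC-self : ∀ q v → moveToC {n} q v v ≡ pC
  moveToC-self q v rewrite dec-true (v ≟ v) refl = refl

  moveToC-other : ∀ q {v w} → w ≢ v → moveToC {n} q v w ≡ q w
  moveToC-other q {v} {w} w≢v rewrite dec-false (w ≟ v) w≢v = refl

  deg≡∑ₑ : ∀ G q → deg G q ≡ ∑ₑ G (atLabels q partsMet)
  deg≡∑ₑ G q = begin
    deg G q
      ≡⟨ cong₂ _+_ (cong₂ _+_ (count≡∑ _ es) (count≡∑ _ es)) (count≡∑ _ es) ⟩
    ∑ₑ G (meets pA) + ∑ₑ G (meets pB) + ∑ₑ G (meets pC)
      ≡⟨ cong (_+ ∑ₑ G (meets pC)) (∑-distrib-+ (meets pA ∘ edge) (meets pB ∘ edge)) ⟨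
    ∑ₑ G (λ ε → meets pA ε + meets pB ε) + ∑ₑ G (meets pC)
      ≡⟨ ∑-distrib-+ (λ i → meets pA (edge i) + meets pB (edge i)) (meets pC ∘ edge) ⟨
    ∑ₑ G (atLabels q partsMet)
      ∎
    where
    open ≡-Reasoning
    es = edges G
    edge = lookup es
    meets : Part → Triple n → ℕ
    meets X (a , b , c) = 𝟙 (q a == X ∨ q b == X ∨ q c == X)

  eOf : Hypergraph3 n → Partition n → EdgeType → ℕ
  eOf G q (X , Y , Z) = e G q X Y Z

  eOf≡∑ₑ : ∀ G q s → eOf G q s ≡ ∑ₑ G (atLabels q (λ x y z → 𝟙 (ofType s x y z)))
  eOf≡∑ₑ G q (X , Y , Z) = count≡∑ _ (edges G)

  ∑ₑ-atLabels-cong : ∀ G q {F H : Part → Part → Part → ℕ} → (∀ x y z → F x y z ≡ H x y z) →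
    ∑ₑ G (atLabels q F) ≡ ∑ₑ G (atLabels q H)
  ∑ₑ-atLabels-cong G q {F} {H} F≡H = sum-cong-≗ (λ i → at (lookup (edges G) i))
    where
    at : ∀ ε → atLabels q F ε ≡ atLabels q H ε
    at (a , b , c) = F≡H (q a) (q b) (q c)

  moveChange : (ℕ → ℕ → ℕ) → Partition n → Fin n → Triple n → ℕ
  moveChange φ q v ε = φ (atLabels q partsMet ε) (atLabels (moveToC q v) partsMet ε)

  ∑-moveChange : ∀ φ → (∀ m → φ m m ≡ 0) → ∀ X q {ε} → Sorted ε →
    ∑[ v < n ] (𝟙 (q v == X) * moveChange φ q v ε) ≡ atLabels q (localChange φ X) ε
  ∑-moveChange φ φ-diag X q {a , b , c} (a<b , b<c) =
    trans (∑-supportedOn₃ _ a≢b a≢c b≢c untouched) (cong₂ _+_ (cong₂ _+_ at-a at-b) at-c)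
    where
    a≢b = <⇒≢ a<b
    b≢c = <⇒≢ b<c
    a≢c = <⇒≢ (<-trans a<b b<c)
    m = partsMet (q a) (q b) (q c)
    untouched : ∀ v → v ≢ a → v ≢ b → v ≢ c → 𝟙 (q v == X) * moveChange φ q v (a , b , c) ≡ 0
    untouched v v≢a v≢b v≢c
      rewrite moveToC-other q (v≢a ∘ sym) | moveToC-other q (v≢b ∘ sym) | moveToC-other q (v≢c ∘ sym)
            | φ-diag m = *-zeroʳ (𝟙 (q v == X))
    at-a : 𝟙 (q a == X) * moveChange φ q a (a , b , c) ≡ 𝟙 (q a == X) * φ m (partsMet pC (q b) (q c))
    at-a rewrite moveToC-self q a | moveToC-other q (a≢b ∘ sym) | moveToC-other q (a≢c ∘ sym) = refl
    at-b : 𝟙 (q b == X) * moveChange φ q b (a , b , c) ≡ 𝟙 (q b == X) * φ m (partsMet (q a) pC (q c))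
    at-b rewrite moveToC-self q b | moveToC-other q a≢b | moveToC-other q (b≢c ∘ sym) = refl
    at-c : 𝟙 (q c == X) * moveChange φ q c (a , b , c) ≡ 𝟙 (q c == X) * φ m (partsMet (q a) (q b) pC)
    at-c rewrite moveToC-self q c | moveToC-other q a≢c | moveToC-other q b≢c = refl

  ∑ₑ-localChange : ∀ φ → (∀ m → φ m m ≡ 0) → ∀ G X q →
    ∑[ v < n ] (𝟙 (q v == X) * ∑ₑ G (moveChange φ q v)) ≡ ∑ₑ G (atLabels q (localChange φ X))
  ∑ₑ-localChange φ φ-diag G X q = begin
    ∑[ v < n ] (𝟙 (q v == X) * ∑ₑ G (moveChange φ q v))
      ≡⟨ sum-cong-≗ (λ v → *-distribˡ-sum (𝟙 (q v == X)) (moveChange φ q v ∘ edge)) ⟩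
    ∑[ v < n ] ∑ₑ G (λ ε → 𝟙 (q v == X) * moveChange φ q v ε)
      ≡⟨ ∑-comm (λ v i → 𝟙 (q v == X) * moveChange φ q v (edge i)) ⟩
    ∑ₑ G (λ ε → ∑[ v < n ] (𝟙 (q v == X) * moveChange φ q v ε))
      ≡⟨ sum-cong-≗ (λ i → ∑-moveChange φ φ-diag X q (All.lookup (sorted G) (∈-lookup i))) ⟩
    ∑ₑ G (atLabels q (localChange φ X)) ∎
    where
    open ≡-Reasoning
    edge = lookup (edges G)

  increase≤decrease : ∀ G q v → deg G (moveToC q v) ≤ deg G q →
    ∑ₑ G (moveChange increase q v) ≤ ∑ₑ G (moveChange decrease q v)
  increase≤decrease G q v moved≤ = +-cancelˡ-≤ (∑ₑ G old) _ _ (begin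
    ∑ₑ G old + ∑ₑ G (moveChange increase q v)  ≡⟨ ∑-distrib-+ (old ∘ edge) _ ⟨
    ∑ₑ G (λ ε → old ε + moveChange increase q v ε)
      ≡⟨ sum-cong-≗ (λ i → m+[n∸m]≡n+[m∸n] (old (edge i)) (new (edge i))) ⟩
    ∑ₑ G (λ ε → new ε + moveChange decrease q v ε)  ≡⟨ ∑-distrib-+ (new ∘ edge) _ ⟩
    ∑ₑ G new + ∑ₑ G (moveChange decrease q v)
      ≤⟨ +-monoˡ-≤ _ (subst₂ _≤_ (deg≡∑ₑ G (moveToC q v)) (deg≡∑ₑ G q) moved≤) ⟩
    ∑ₑ G old + ∑ₑ G (moveChange decrease q v)  ∎)
    where
    open ≤-Reasoning
    edge = lookup (edges G)
    old new : Triple n → ℕ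
    old = atLabels q partsMet
    new = atLabels (moveToC q v) partsMet

  localIncrease≤localDecrease : ∀ G q X → (∀ v → q v ≡ X → deg G (moveToC q v) ≤ deg G q) →
    ∑ₑ G (atLabels q (localChange increase X)) ≤ ∑ₑ G (atLabels q (localChange decrease X))
  localIncrease≤localDecrease G q X optimal = begin
    ∑ₑ G (atLabels q (localChange increase X))
      ≡⟨ ∑ₑ-localChange increase n∸n≡0 G X q ⟨
    ∑[ v < n ] (𝟙 (q v == X) * ∑ₑ G (moveChange increase q v))
      ≤⟨ ∑-mono-≤ at-vertex ⟩
    ∑[ v < n ] (𝟙 (q v == X) * ∑ₑ G (moveChange decrease q v))
      ≡⟨ ∑ₑ-localChange decrease n∸n≡0 G X q ⟩
    ∑ₑ G (atLabels q (localChange decrease X))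
      ∎
    where
    open ≤-Reasoning
    at-vertex : ∀ v → 𝟙 (q v == X) * ∑ₑ G (moveChange increase q v)
                    ≤ 𝟙 (q v == X) * ∑ₑ G (moveChange decrease q v)
    at-vertex v with q v == X in qv==X
    ... | true  = *-monoʳ-≤ 1 (increase≤decrease G q v (optimal v (==⇒≡ (q v) X qv==X)))
    ... | false = z≤n

  semiOptimal-bound : ∀ G q X k l s t u w →
    (∀ x y z → localChange increase X x y z ≡ k * 𝟙 (ofType s x y z) + l * 𝟙 (ofType t x y z)) →
    (∀ x y z → localChange decrease X x y z ≡ 𝟙 (ofType u x y z) + 𝟙 (ofType w x y z)) →
    (∀ v → q v ≡ X → deg G (moveToC q v) ≤ deg G q) →
    k * eOf G q s + l * eOf G q t ≤ eOf G q u + eOf G q w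
  semiOptimal-bound G q X k l s t u w increase≡ decrease≡ optimal = begin
    k * eOf G q s + l * eOf G q t
      ≡⟨ cong₂ _+_ (cong (k *_) (eOf≡∑ₑ G q s)) (cong (l *_) (eOf≡∑ₑ G q t)) ⟩
    k * ∑ₑ G (isOfType s) + l * ∑ₑ G (isOfType t)
      ≡⟨ cong₂ _+_ (*-distribˡ-sum k (isOfType s ∘ edge)) (*-distribˡ-sum l (isOfType t ∘ edge)) ⟩
    ∑ₑ G (λ ε → k * isOfType s ε) + ∑ₑ G (λ ε → l * isOfType t ε)
      ≡⟨ ∑-distrib-+ (λ i → k * isOfType s (edge i)) (λ i → l * isOfType t (edge i)) ⟨
    ∑ₑ G (λ ε → k * isOfType s ε + l * isOfType t ε)
      ≡⟨ ∑ₑ-atLabels-cong G q increase≡ ⟨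
    ∑ₑ G (atLabels q (localChange increase X))
      ≤⟨ localIncrease≤localDecrease G q X optimal ⟩
    ∑ₑ G (atLabels q (localChange decrease X))
      ≡⟨ ∑ₑ-atLabels-cong G q decrease≡ ⟩
    ∑ₑ G (λ ε → isOfType u ε + isOfType w ε)
      ≡⟨ ∑-distrib-+ (isOfType u ∘ edge) (isOfType w ∘ edge) ⟩
    ∑ₑ G (isOfType u) + ∑ₑ G (isOfType w)
      ≡⟨ cong₂ _+_ (eOf≡∑ₑ G q u) (eOf≡∑ₑ G q w) ⟨
    eOf G q u + eOf G q w ∎
    where
    open ≤-Reasoning
    edge = lookup (edges G)
    isOfType : EdgeType → Triple n → ℕ
    isOfType s = atLabels q (λ x y z → 𝟙 (ofType s x y z))

increase-at-A : ∀ x y z → localChange increase pA x y z ≡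
  3 * 𝟙 (ofType (pA , pA , pA) x y z) + 2 * 𝟙 (ofType (pA , pA , pB) x y z)
increase-at-A = Part³-≡ (localChange increase pA)
  (λ x y z → 3 * 𝟙 (ofType (pA , pA , pA) x y z) + 2 * 𝟙 (ofType (pA , pA , pB) x y z)) _

decrease-at-A : ∀ x y z → localChange decrease pA x y z ≡
  𝟙 (ofType (pA , pB , pC) x y z) + 𝟙 (ofType (pA , pC , pC) x y z)
decrease-at-A = Part³-≡ (localChange decrease pA)
  (λ x y z → 𝟙 (ofType (pA , pB , pC) x y z) + 𝟙 (ofType (pA , pC , pC) x y z)) _

increase-at-B : ∀ x y z → localChange increase pB x y z ≡
  3 * 𝟙 (ofType (pB , pB , pB) x y z) + 2 * 𝟙 (ofType (pA , pB , pB) x y z)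
increase-at-B = Part³-≡ (localChange increase pB)
  (λ x y z → 3 * 𝟙 (ofType (pB , pB , pB) x y z) + 2 * 𝟙 (ofType (pA , pB , pB) x y z)) _

decrease-at-B : ∀ x y z → localChange decrease pB x y z ≡
  𝟙 (ofType (pA , pB , pC) x y z) + 𝟙 (ofType (pB , pC , pC) x y z)
decrease-at-B = Part³-≡ (localChange decrease pB)
  (λ x y z → 𝟙 (ofType (pA , pB , pC) x y z) + 𝟙 (ofType (pB , pC , pC) x y z)) _

lemma1 : ∀ {n} (G : Hypergraph3 n) (p : Partition n) → SemiOptimal G p →
    (3 * e G p pA pA pA + 2 * e G p pA pA pB ≤ e G p pA pB pC + e G p pA pC pC) ×
    (3 * e G p pB pB pB + 2 * e G p pA pB pB ≤ e G p pA pB pC + e G p pB pC pC)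
lemma1 G p (optimal-A , optimal-B) =
    semiOptimal-bound G p pA 3 2 (pA , pA , pA) (pA , pA , pB) (pA , pB , pC) (pA , pC , pC)
      increase-at-A decrease-at-A optimal-A
  , semiOptimal-bound G p pB 3 2 (pB , pB , pB) (pA , pB , pB) (pA , pB , pC) (pB , pC , pC)
      increase-at-B decrease-at-B optimal-B
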